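{- Let $m\geq 2$ and $1\leq i\leq m-1$. Then $$\frac{d_i(m)^2}{d_{i-1}(m)d_{i+1}(m)}>\frac{(m-i+1)(i+1)(m+i)}{(m-i)\,i\,(m+i+1)}.$$
   Context: For integers $m\geq 0$, the Boros-Moll polynomial is $P_m(a)=2^{ -2m}\sum_{k}2^k\binom{2m-2k}{m-k}\binom{m+k}{k}(a+1)^k=\sum_{i=0}^m d_i(m)a^i$, so that $d_i(m)=2^{ -2m}\sum_{k=0}^m 2^k\binom{2m-2k}{m-k}\binom{m+k}{m}\binom{k}{i}$ for $0\le i\le m$. These coefficients are positive. -}

module Defs where

open import Data.Nat using (ℕ; suc; _+_; _*_; _∸_; _^_)
open import Data.Nat.Properties using (m^n≢0)
open import Data.Nat.Combinatorics using (_C_)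
open import Data.List using (map; upTo)
open import Data.Nat.ListAction using (sum)
open import Data.Integer using (+_)
open import Data.Rational using (ℚ; _/_)

sumTo : ℕ → (ℕ → ℕ) → ℕ
sumTo m f = sum (map f (upTo (suc m)))

dNum : ℕ → ℕ → ℕ
dNum i m = sumTo m (λ k → (2 ^ k) * ((2 * m ∸ 2 * k) C (m ∸ k)) * ((m + k) C m) * (k C i))

d : ℕ → ℕ → ℚ
d i m = _/_ (+ dNum i m) (2 ^ (2 * m)) {{m^n≢0 2 (2 * m)}}

ι : ℕ → ℚ
ι n = (+ n) / 1

module Submission where

open import Defs
open import Data.Nat using (ℕ; suc; _+_; _*_; _∸_; _≤_)
open import Data.Rational using (ℚ; _>_; _÷_; NonZero)
import Data.Rational as ℚ

open import Data.Nat using (zero; _<_; _^_; z≤n; s≤s; _≤?_)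
import Data.Nat as ℕ using (NonZero; pred; >-nonZero⁻¹)
open import Data.Nat.Properties
open import Data.Nat.Tactic.RingSolver using (solve)
open import Data.Nat.Combinatorics using (_C_; nCk+nC[k+1]≡[n+1]C[k+1]; k>n⇒nCk≡0)
open import Data.Nat.ListAction using (sum)
open import Data.List using ([]; _∷_; map; upTo; applyUpTo)
open import Data.List.Properties using (map-upTo)
open import Data.Integer as ℤ using (+_)
import Data.Integer.Properties as ℤP
import Data.Rational.Properties as ℚP
open import Data.Rational.Unnormalised as ℚᵘ using (mkℚᵘ; *≡*; *<*)
import Data.Rational.Unnormalised.Properties as ℚᵘP
open import Data.Rational.Solver using (module +-*-Solver)
open import Data.Product using (_,_)
open import Algebra.Properties.CommutativeSemigroup +-commutativeSemigroup
  using () renaming (interchange to +-interchange)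
open import Relation.Nullary using (yes; no)
open import Relation.Binary.PropositionalEquality

-- Write  D_i(m) = 2^{2m} d_i(m) = Σ_{k≤m} w(m,k) C(k,i)  with the weights
-- w(m,k) = 2^k C(2m-2k, m-k) C(m+k, m);  the statement is then an inequality
-- between natural numbers, and the proof has four stages.
--
-- 1. Binomial identities (absorption, ratio of neighbours, a three-term
--    relation along a row) and the ratio  w(m,k+1)/w(m,k)  give a summand-wise
--    identity; summing it over k, its extra terms telescope, and we obtain the
--    three-term recurrence
--       (i+1)(i+2) D_{i+2} + (m-i)(m+i+1) D_i = (i+1)(2m+1) D_{i+1}.
-- 2. Descending induction on i from i = m, where D_{m+1} = 0, turns the
--    recurrence into the bound  (i+1)(m+i+2) D_{i+1} ≤ (m-i)(m+i+1) D_i,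
--    which is strict when i + 2 ≤ m.
-- 3. At index i-1 the recurrence reads  w + u = p + q  with  q ≤ p < u  by the
--    strict bound, and the exchange inequality  u w < p q  is the theorem for
--    the D_i over ℕ.
-- 4. Finally the common denominator 2^{2m} is cleared in ℚ.

-- Binomial coefficients by Pascal's rule; the recursion makes induction on
-- both arguments immediate.
binom : ℕ → ℕ → ℕ
binom n       zero    = 1
binom zero    (suc k) = 0
binom (suc n) (suc k) = binom n k + binom n (suc k)

binom≡C : ∀ n k → binom n k ≡ n C k
binom≡C n       zero    = refl
binom≡C zero    (suc k) = sym (k>n⇒nCk≡0 {0} {suc k} (s≤s z≤n))
binom≡C (suc n) (suc k) =
  trans (cong₂ _+_ (binom≡C n k) (binom≡C n (suc k))) (nCk+nC[k+1]≡[n+1]C[k+1] n k)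

binom-vanish : ∀ {n k} → n < k → binom n k ≡ 0
binom-vanish {zero}  {suc k} _         = refl
binom-vanish {suc n} {suc k} (s≤s n<k) =
  cong₂ _+_ (binom-vanish n<k) (binom-vanish (m<n⇒m<1+n n<k))

binom-pos : ∀ {n k} → k ≤ n → 0 < binom n k
binom-pos {n}     {zero}  _         = s≤s z≤n
binom-pos {suc n} {suc k} (s≤s k≤n) = <-≤-trans (binom-pos k≤n) (m≤m+n _ _)

binom-one : ∀ n → binom n 1 ≡ n
binom-one zero    = refl
binom-one (suc n) = cong suc (binom-one n)

binom-absorb : ∀ n k → suc k * binom (suc n) (suc k) ≡ suc n * binom n k
binom-absorb n       zero    = begin
  1 * binom (suc n) 1 ≡⟨ *-identityˡ _ ⟩
  binom (suc n) 1     ≡⟨ binom-one (suc n) ⟩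
  suc n               ≡⟨ *-identityʳ _ ⟨
  suc n * 1           ∎
  where open ≡-Reasoning
binom-absorb zero    (suc k) = *-zeroʳ (suc (suc k))
binom-absorb (suc n) (suc k) =
  pascal-step (binom n k) (binom n (suc k)) (binom (suc n) (suc (suc k)))
    (binom-absorb n k) (binom-absorb n (suc k))
  where
  open ≡-Reasoning
  pascal-step : ∀ x y z → suc k * (x + y) ≡ suc n * x → suc (suc k) * z ≡ suc n * y →
                suc (suc k) * (x + y + z) ≡ suc (suc n) * (x + y)
  pascal-step x y z hx hz = begin
    suc (suc k) * (x + y + z)                   ≡⟨ solve (k ∷ x ∷ y ∷ z ∷ []) ⟩
    suc k * (x + y) + (x + y) + suc (suc k) * z ≡⟨ cong₂ (λ a b → a + (x + y) + b) hx hz ⟩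
    suc n * x + (x + y) + suc n * y             ≡⟨ solve (n ∷ x ∷ y ∷ []) ⟩
    suc (suc n) * (x + y)                       ∎

binom-absorb-bottom : ∀ a b → suc b * binom (suc (a + b)) a ≡ suc (a + b) * binom (a + b) a
binom-absorb-bottom zero    b = refl
binom-absorb-bottom (suc a) b =
  cancel (binom (suc (a + b)) a) (binom (suc (a + b)) (suc a)) (binom-absorb (suc (a + b)) a)
  where
  open ≡-Reasoning
  cancel : ∀ u v → suc a * (u + v) ≡ suc (suc (a + b)) * u →
           suc b * (u + v) ≡ suc (suc (a + b)) * v
  cancel u v h = +-cancelʳ-≡ (suc a * (u + v)) _ _ (begin
    suc b * (u + v) + suc a * (u + v)
      ≡⟨ solve (a ∷ b ∷ u ∷ v ∷ []) ⟩
    suc (suc (a + b)) * v + suc (suc (a + b)) * u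
      ≡⟨ cong (_+_ (suc (suc (a + b)) * v)) h ⟨
    suc (suc (a + b)) * v + suc a * (u + v) ∎)

binom-ratio : ∀ a b → suc a * binom (a + b) (suc a) ≡ b * binom (a + b) a
binom-ratio a zero    =
  trans (cong (suc a *_) (binom-vanish (s≤s (≤-reflexive (+-identityʳ a))))) (*-zeroʳ (suc a))
binom-ratio a (suc b) =
  subst (λ n → suc a * binom n (suc a) ≡ suc b * binom n a) (sym (+-suc a b))
    (trans (binom-absorb (a + b) a) (sym (binom-absorb-bottom a b)))

binom-three-term : ∀ j s →
  suc j * suc (suc j) * binom (j + s) (suc (suc j)) + (j + s + suc j) * s * binom (j + s) j
    ≡ 2 * suc j * (j + s) * binom (j + s) (suc j)
binom-three-term j zero =
  vanishing (binom (j + 0) j) _ _ (binom-vanish j+0<1+j) (binom-vanish (m<n⇒m<1+n j+0<1+j))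
  where
  j+0<1+j : j + 0 < suc j
  j+0<1+j = s≤s (≤-reflexive (+-identityʳ j))
  vanishing : ∀ x₀ x₁ x₂ → x₁ ≡ 0 → x₂ ≡ 0 →
    suc j * suc (suc j) * x₂ + (j + 0 + suc j) * 0 * x₀ ≡ 2 * suc j * (j + 0) * x₁
  vanishing x₀ _ _ refl refl = solve (j ∷ x₀ ∷ [])
binom-three-term j (suc s) =
  combine (binom (j + suc s) j) (binom (j + suc s) (suc j)) (binom (j + suc s) (suc (suc j)))
    (binom-ratio j (suc s))
    (subst (λ k → suc (suc j) * binom k (suc (suc j)) ≡ s * binom k (suc j))
       (sym (+-suc j s)) (binom-ratio (suc j) s))
  where
  open ≡-Reasoning
  combine : ∀ x₀ x₁ x₂ → suc j * x₁ ≡ suc s * x₀ → suc (suc j) * x₂ ≡ s * x₁ →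
    suc j * suc (suc j) * x₂ + (j + suc s + suc j) * suc s * x₀ ≡ 2 * suc j * (j + suc s) * x₁
  combine x₀ x₁ x₂ h₁ h₂ = begin
    suc j * suc (suc j) * x₂ + (j + suc s + suc j) * suc s * x₀
      ≡⟨ solve (j ∷ s ∷ x₀ ∷ x₂ ∷ []) ⟩
    suc j * (suc (suc j) * x₂) + (j + suc s + suc j) * (suc s * x₀)
      ≡⟨ cong₂ (λ a b → suc j * a + (j + suc s + suc j) * b) h₂ (sym h₁) ⟩
    suc j * (s * x₁) + (j + suc s + suc j) * (suc j * x₁)
      ≡⟨ solve (j ∷ s ∷ x₁ ∷ []) ⟩
    2 * suc j * (j + suc s) * x₁ ∎

binom-central : ∀ q → suc q * binom (suc q + suc q) (suc q) ≡ 2 * suc (q + q) * binom (q + q) q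
binom-central q = *-cancelˡ-≡ _ _ (suc q)
  (combine _ _ _ (binom-absorb (q + suc q) q)
    (subst (λ n → suc q * binom n q ≡ suc (q + q) * binom (q + q) q)
       (sym (+-suc q q)) (binom-absorb-bottom q q)))
  where
  open ≡-Reasoning
  combine : ∀ x₀ x₁ x₂ → suc q * x₂ ≡ suc (q + suc q) * x₁ → suc q * x₁ ≡ suc (q + q) * x₀ →
            suc q * (suc q * x₂) ≡ suc q * (2 * suc (q + q) * x₀)
  combine x₀ x₁ x₂ h₂ h₁ = begin
    suc q * (suc q * x₂)                    ≡⟨ cong (suc q *_) h₂ ⟩
    suc q * (suc (q + suc q) * x₁)          ≡⟨ solve (q ∷ x₁ ∷ []) ⟩
    suc (q + suc q) * (suc q * x₁)          ≡⟨ cong (suc (q + suc q) *_) h₁ ⟩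
    suc (q + suc q) * (suc (q + q) * x₀)    ≡⟨ solve (q ∷ x₀ ∷ []) ⟩
    suc q * (2 * suc (q + q) * x₀)          ∎

weight : ℕ → ℕ → ℕ
weight m k = 2 ^ k * binom (2 * m ∸ 2 * k) (m ∸ k) * binom (m + k) m

double-diff : ∀ a b → 2 * (a + b) ∸ 2 * a ≡ b + b
double-diff a b = begin
  2 * (a + b) ∸ 2 * a    ≡⟨ cong (_∸ 2 * a) (*-distribˡ-+ 2 a b) ⟩
  2 * a + 2 * b ∸ 2 * a  ≡⟨ m+n∸m≡n (2 * a) (2 * b) ⟩
  b + (b + 0)            ≡⟨ cong (_+_ b) (+-identityʳ b) ⟩
  b + b                  ∎
  where open ≡-Reasoning

weight-eval : ∀ a b → weight (a + b) a ≡ 2 ^ a * binom (b + b) b * binom (a + b + a) (a + b)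
weight-eval a b = cong₂ (λ x y → 2 ^ a * binom x y * binom (a + b + a) (a + b))
  (double-diff a b) (m+n∸m≡n a b)

weight-ratio : ∀ m k q → m ≡ k + suc q →
  suc k * suc (q + q) * weight m (suc k) ≡ suc q * (m + suc k) * weight m k
weight-ratio m k q refl = begin
  suc k * suc (q + q) * weight m (suc k)
    ≡⟨ cong (suc k * suc (q + q) *_) w₁ ⟩
  suc k * suc (q + q) * (2 * 2 ^ k * binom (q + q) q * binom (m + suc k) m)
    ≡⟨ combine (2 ^ k) _ _ _ _ (binom-central q) bottom ⟩
  suc q * (m + suc k) * (2 ^ k * binom (suc q + suc q) (suc q) * binom (m + k) m)
    ≡⟨ cong (suc q * (m + suc k) *_) (weight-eval k (suc q)) ⟨
  suc q * (m + suc k) * weight m k ∎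
  where
  open ≡-Reasoning
  w₁ : weight m (suc k) ≡ 2 * 2 ^ k * binom (q + q) q * binom (m + suc k) m
  w₁ = subst (λ n → weight n (suc k) ≡ 2 * 2 ^ k * binom (q + q) q * binom (n + suc k) n)
         (sym (+-suc k q)) (weight-eval (suc k) q)
  bottom : suc k * binom (m + suc k) m ≡ (m + suc k) * binom (m + k) m
  bottom = subst (λ n → suc k * binom n m ≡ n * binom (m + k) m)
             (sym (+-suc m k)) (binom-absorb-bottom m k)
  combine : ∀ p c₀ c₁ y₀ y₁ → suc q * c₀ ≡ 2 * suc (q + q) * c₁ → suc k * y₁ ≡ (m + suc k) * y₀ →
    suc k * suc (q + q) * (2 * p * c₁ * y₁) ≡ suc q * (m + suc k) * (p * c₀ * y₀)
  combine p c₀ c₁ y₀ y₁ hc hy = begin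
    suc k * suc (q + q) * (2 * p * c₁ * y₁)         ≡⟨ solve (k ∷ q ∷ p ∷ c₁ ∷ y₁ ∷ []) ⟩
    p * (2 * suc (q + q) * c₁) * (suc k * y₁)      ≡⟨ cong₂ (λ a b → p * a * b) (sym hc) hy ⟩
    p * (suc q * c₀) * ((m + suc k) * y₀)          ≡⟨ solve (q ∷ k ∷ p ∷ c₀ ∷ y₀ ∷ []) ⟩
    suc q * (m + suc k) * (p * c₀ * y₀)            ∎

Σ< : ℕ → (ℕ → ℕ) → ℕ
Σ< zero    f = 0
Σ< (suc n) f = Σ< n f + f n

Σ<-cong : ∀ n {f g} → (∀ k → k < n → f k ≡ g k) → Σ< n f ≡ Σ< n g
Σ<-cong zero    eq = refl
Σ<-cong (suc n) eq = cong₂ _+_ (Σ<-cong n (λ k k<n → eq k (m<n⇒m<1+n k<n))) (eq n ≤-refl)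

Σ<-zero : ∀ n {f} → (∀ k → k < n → f k ≡ 0) → Σ< n f ≡ 0
Σ<-zero zero    eq = refl
Σ<-zero (suc n) eq = cong₂ _+_ (Σ<-zero n (λ k k<n → eq k (m<n⇒m<1+n k<n))) (eq n ≤-refl)

Σ<-+ : ∀ n f g → Σ< n (λ k → f k + g k) ≡ Σ< n f + Σ< n g
Σ<-+ zero    f g = refl
Σ<-+ (suc n) f g =
  trans (cong (_+ (f n + g n)) (Σ<-+ n f g)) (+-interchange (Σ< n f) (Σ< n g) (f n) (g n))

Σ<-scale : ∀ n a f → Σ< n (λ k → a * f k) ≡ a * Σ< n f
Σ<-scale zero    a f = sym (*-zeroʳ a)
Σ<-scale (suc n) a f =
  trans (cong (_+ a * f n) (Σ<-scale n a f)) (sym (*-distribˡ-+ a (Σ< n f) (f n)))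

Σ<-first : ∀ n f → Σ< (suc n) f ≡ f 0 + Σ< n (λ k → f (suc k))
Σ<-first zero    f = +-comm 0 (f 0)
Σ<-first (suc n) f = trans (cong (_+ f (suc n)) (Σ<-first n f)) (+-assoc (f 0) _ _)

Σ<-cancel : ∀ n {f g G H} → (∀ k → k < n → f k + G k ≡ g k + H k) → Σ< n G ≡ Σ< n H →
            Σ< n f ≡ Σ< n g
Σ<-cancel n {f} {g} {G} {H} eq ΣG≡ΣH = +-cancelʳ-≡ (Σ< n G) _ _ (begin
  Σ< n f + Σ< n G              ≡⟨ Σ<-+ n f G ⟨
  Σ< n (λ k → f k + G k)       ≡⟨ Σ<-cong n eq ⟩
  Σ< n (λ k → g k + H k)       ≡⟨ Σ<-+ n g H ⟩
  Σ< n g + Σ< n H              ≡⟨ cong (_+_ (Σ< n g)) ΣG≡ΣH ⟨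
  Σ< n g + Σ< n G              ∎)
  where open ≡-Reasoning

Σ<-telescope : ∀ n {G H} → G 0 ≡ 0 → H n ≡ 0 → (∀ k → k < n → H k ≡ G (suc k)) →
               Σ< (suc n) G ≡ Σ< (suc n) H
Σ<-telescope n {G} {H} G0 Hn link = begin
  Σ< (suc n) G                   ≡⟨ Σ<-first n G ⟩
  G 0 + Σ< n (λ k → G (suc k))   ≡⟨ cong (_+ Σ< n (λ k → G (suc k))) G0 ⟩
  Σ< n (λ k → G (suc k))         ≡⟨ Σ<-cong n link ⟨
  Σ< n H                         ≡⟨ +-identityʳ (Σ< n H) ⟨
  Σ< n H + 0                     ≡⟨ cong (_+_ (Σ< n H)) Hn ⟨
  Σ< (suc n) H                   ∎
  where open ≡-Reasoning

Σ<-applyUpTo : ∀ n f → sum (applyUpTo f n) ≡ Σ< n f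
Σ<-applyUpTo zero    f = refl
Σ<-applyUpTo (suc n) f =
  trans (cong (_+_ (f 0)) (Σ<-applyUpTo n (λ k → f (suc k)))) (sym (Σ<-first n f))

dSum : ℕ → ℕ → ℕ
dSum i m = Σ< (suc m) (λ k → weight m k * binom k i)

dNum≡dSum : ∀ i m → dNum i m ≡ dSum i m
dNum≡dSum i m = begin
  sum (map term (upTo (suc m)))           ≡⟨ cong sum (map-upTo term (suc m)) ⟩
  sum (applyUpTo term (suc m))            ≡⟨ Σ<-applyUpTo (suc m) term ⟩
  Σ< (suc m) term                         ≡⟨ Σ<-cong (suc m) (λ k _ → library-binom k) ⟨
  dSum i m                                ∎
  where
  open ≡-Reasoning
  term : ℕ → ℕ
  term k = 2 ^ k * ((2 * m ∸ 2 * k) C (m ∸ k)) * ((m + k) C m) * (k C i)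
  library-binom : ∀ k → weight m k * binom k i ≡ term k
  library-binom k rewrite binom≡C (2 * m ∸ 2 * k) (m ∸ k) | binom≡C (m + k) m | binom≡C k i = refl

-- For k < j every binomial vanishes; otherwise it is the three-term relation
-- along the row k, rearranged.
binom-recurrence-term : ∀ m j t k q → m ≡ j + t → m ≡ k + q →
  suc j * suc (suc j) * binom k (suc (suc j)) + t * (m + suc j) * binom k j
    + suc j * suc (q + q) * binom k (suc j)
  ≡ suc j * suc (m + m) * binom k (suc j) + q * (m + suc k) * binom k j
binom-recurrence-term m j t k q m≡j+t m≡k+q with j ≤? k
... | no j≰k =
  vanishing (binom k j) (binom k (suc j)) (binom k (suc (suc j)))
    (binom-vanish k<j) (binom-vanish (m<n⇒m<1+n k<j)) (binom-vanish (m<n⇒m<1+n (m<n⇒m<1+n k<j)))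
  where
  k<j : k < j
  k<j = ≰⇒> j≰k
  vanishing : ∀ x₀ x₁ x₂ → x₀ ≡ 0 → x₁ ≡ 0 → x₂ ≡ 0 →
    suc j * suc (suc j) * x₂ + t * (m + suc j) * x₀ + suc j * suc (q + q) * x₁
    ≡ suc j * suc (m + m) * x₁ + q * (m + suc k) * x₀
  vanishing _ _ _ refl refl refl = solve (j ∷ t ∷ m ∷ q ∷ k ∷ [])
... | yes j≤k with m≤n⇒∃[o]m+o≡n j≤k
... | s , refl = combine m t (binom k j) (binom k (suc j)) (binom k (suc (suc j)))
                   m≡k+q t≡s+q (binom-three-term j s)
  where
  open ≡-Reasoning
  t≡s+q : t ≡ s + q
  t≡s+q = +-cancelˡ-≡ j t (s + q) (trans (sym m≡j+t) (trans m≡k+q (+-assoc j s q)))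
  combine : ∀ m′ t′ x₀ x₁ x₂ → m′ ≡ j + s + q → t′ ≡ s + q →
    suc j * suc (suc j) * x₂ + (j + s + suc j) * s * x₀ ≡ 2 * suc j * (j + s) * x₁ →
    suc j * suc (suc j) * x₂ + t′ * (m′ + suc j) * x₀ + suc j * suc (q + q) * x₁
    ≡ suc j * suc (m′ + m′) * x₁ + q * (m′ + suc (j + s)) * x₀
  combine _ _ x₀ x₁ x₂ refl refl row = begin
    suc j * suc (suc j) * x₂ + (s + q) * (j + s + q + suc j) * x₀ + suc j * suc (q + q) * x₁
      ≡⟨ solve (j ∷ s ∷ q ∷ x₀ ∷ x₁ ∷ x₂ ∷ []) ⟩
    (suc j * suc (suc j) * x₂ + (j + s + suc j) * s * x₀)
      + (q * (j + s + q + suc (j + s)) * x₀ + suc j * suc (q + q) * x₁)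
      ≡⟨ cong (_+ (q * (j + s + q + suc (j + s)) * x₀ + suc j * suc (q + q) * x₁)) row ⟩
    2 * suc j * (j + s) * x₁ + (q * (j + s + q + suc (j + s)) * x₀ + suc j * suc (q + q) * x₁)
      ≡⟨ solve (j ∷ s ∷ q ∷ x₀ ∷ x₁ ∷ []) ⟩
    suc j * suc (j + s + q + (j + s + q)) * x₁ + q * (j + s + q + suc (j + s)) * x₀ ∎

telescope-link : ∀ m j k → k < m →
  (m ∸ k) * (m + suc k) * (weight m k * binom k j)
    ≡ suc j * suc ((m ∸ suc k) + (m ∸ suc k)) * (weight m (suc k) * binom (suc k) (suc j))
telescope-link m j k k<m with m≤n⇒∃[o]m+o≡n k<m
... | q , refl = begin
  (suc (k + q) ∸ k) * (m + suc k) * (weight m k * binom k j)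
    ≡⟨ cong (λ z → z * (m + suc k) * (weight m k * binom k j)) m∸k ⟩
  suc q * (m + suc k) * (weight m k * binom k j)
    ≡⟨ combine (weight m k) (weight m (suc k)) (binom k j) (binom (suc k) (suc j))
         (weight-ratio m k q (sym (+-suc k q))) (binom-absorb k j) ⟩
  suc j * suc (q + q) * (weight m (suc k) * binom (suc k) (suc j))
    ≡⟨ cong (λ z → suc j * suc (z + z) * (weight m (suc k) * binom (suc k) (suc j)))
         (sym (m+n∸m≡n k q)) ⟩
  suc j * suc ((k + q ∸ k) + (k + q ∸ k)) * (weight m (suc k) * binom (suc k) (suc j)) ∎
  where
  open ≡-Reasoning
  m∸k : suc (k + q) ∸ k ≡ suc q
  m∸k = trans (cong (_∸ k) (sym (+-suc k q))) (m+n∸m≡n k (suc q))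
  combine : ∀ w₀ w₁ x y →
    suc k * suc (q + q) * w₁ ≡ suc q * (suc (k + q) + suc k) * w₀ → suc j * y ≡ suc k * x →
    suc q * (suc (k + q) + suc k) * (w₀ * x) ≡ suc j * suc (q + q) * (w₁ * y)
  combine w₀ w₁ x y hw hb = begin
    suc q * (suc (k + q) + suc k) * (w₀ * x)   ≡⟨ solve (q ∷ k ∷ w₀ ∷ x ∷ []) ⟩
    (suc q * (suc (k + q) + suc k) * w₀) * x   ≡⟨ cong (_* x) hw ⟨
    (suc k * suc (q + q) * w₁) * x             ≡⟨ solve (k ∷ q ∷ w₁ ∷ x ∷ []) ⟩
    suc (q + q) * w₁ * (suc k * x)             ≡⟨ cong (suc (q + q) * w₁ *_) hb ⟨
    suc (q + q) * w₁ * (suc j * y)             ≡⟨ solve (q ∷ j ∷ w₁ ∷ y ∷ []) ⟩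
    suc j * suc (q + q) * (w₁ * y)             ∎

-- Sum the summand-wise form over k ≤ m; the extra terms telescope away.
dSum-recurrence : ∀ m j t → m ≡ j + t →
  suc j * suc (suc j) * dSum (suc (suc j)) m + t * (m + suc j) * dSum j m
    ≡ suc j * suc (m + m) * dSum (suc j) m
dSum-recurrence m j t m≡j+t = begin
  a₂ * dSum (suc (suc j)) m + a₀ * dSum j m
    ≡⟨ cong₂ _+_ (Σ<-scale n a₂ (f (suc (suc j)))) (Σ<-scale n a₀ (f j)) ⟨
  Σ< n (λ k → a₂ * f (suc (suc j)) k) + Σ< n (λ k → a₀ * f j k)
    ≡⟨ Σ<-+ n _ _ ⟨
  Σ< n (λ k → a₂ * f (suc (suc j)) k + a₀ * f j k)
    ≡⟨ Σ<-cancel n (λ k k<n → termwise k (≤-pred k<n)) telescoped ⟩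
  Σ< n (λ k → a₁ * f (suc j) k)
    ≡⟨ Σ<-scale n a₁ (f (suc j)) ⟩
  a₁ * dSum (suc j) m ∎
  where
  open ≡-Reasoning
  n a₂ a₀ a₁ : ℕ
  n = suc m
  a₂ = suc j * suc (suc j)
  a₀ = t * (m + suc j)
  a₁ = suc j * suc (m + m)
  f : ℕ → ℕ → ℕ
  f i k = weight m k * binom k i
  G H : ℕ → ℕ
  G k = suc j * suc ((m ∸ k) + (m ∸ k)) * f (suc j) k
  H k = (m ∸ k) * (m + suc k) * f j k
  scaled : ∀ c₂ c₀ c₁ d₁ d₀ w x₀ x₁ x₂ →
    c₂ * x₂ + c₀ * x₀ + c₁ * x₁ ≡ d₁ * x₁ + d₀ * x₀ →
    c₂ * (w * x₂) + c₀ * (w * x₀) + c₁ * (w * x₁) ≡ d₁ * (w * x₁) + d₀ * (w * x₀)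
  scaled c₂ c₀ c₁ d₁ d₀ w x₀ x₁ x₂ eq = begin
    c₂ * (w * x₂) + c₀ * (w * x₀) + c₁ * (w * x₁)
      ≡⟨ solve (c₂ ∷ c₀ ∷ c₁ ∷ w ∷ x₀ ∷ x₁ ∷ x₂ ∷ []) ⟩
    w * (c₂ * x₂ + c₀ * x₀ + c₁ * x₁)   ≡⟨ cong (w *_) eq ⟩
    w * (d₁ * x₁ + d₀ * x₀)             ≡⟨ solve (d₁ ∷ d₀ ∷ w ∷ x₀ ∷ x₁ ∷ []) ⟩
    d₁ * (w * x₁) + d₀ * (w * x₀)       ∎
  termwise : ∀ k → k ≤ m → a₂ * f (suc (suc j)) k + a₀ * f j k + G k ≡ a₁ * f (suc j) k + H k
  termwise k k≤m =
    scaled a₂ a₀ (suc j * suc ((m ∸ k) + (m ∸ k))) a₁ ((m ∸ k) * (m + suc k))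
      (weight m k) (binom k j) (binom k (suc j)) (binom k (suc (suc j)))
    (binom-recurrence-term m j t k (m ∸ k) m≡j+t (sym (m+[n∸m]≡n k≤m)))
  telescoped : Σ< n G ≡ Σ< n H
  telescoped = Σ<-telescope m
    (trans (cong (suc j * suc (m + m) *_) (*-zeroʳ (weight m 0))) (*-zeroʳ (suc j * suc (m + m))))
    (cong (λ z → z * (m + suc m) * f j m) (n∸n≡0 m))
    (telescope-link m j)

*-pos : ∀ {a b} → 0 < a → 0 < b → 0 < a * b
*-pos {suc a} {suc b} _ _ = s≤s z≤n

dSum-vanish : ∀ {i m} → m < i → dSum i m ≡ 0
dSum-vanish {i} {m} m<i = Σ<-zero (suc m) λ k k≤m →
  trans (cong (weight m k *_) (binom-vanish (<-≤-trans k≤m m<i))) (*-zeroʳ (weight m k))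

-- D_i(m) > 0 for i ≤ m, already because of the summand k = m.
dSum-pos : ∀ {i m} → i ≤ m → 0 < dSum i m
dSum-pos {i} {m} i≤m = <-≤-trans (*-pos weight-m-pos (binom-pos i≤m)) (m≤n+m _ _)
  where
  weight-m-pos : 0 < weight m m
  weight-m-pos = subst (0 <_)
    (sym (cong₂ (λ x y → 2 ^ m * binom x y * binom (m + m) m) (n∸n≡0 (2 * m)) (n∸n≡0 m)))
    (*-pos (*-pos (m^n>0 2 m) (s≤s z≤n)) (binom-pos (m≤n+m m m)))

-- For  m = j + t + 1  the factor 2m+1 of the recurrence at j splits as
-- (m+j+2) + t,  which puts the recurrence in the form
--   (j+1)(j+2) x₂ + (t+1)(m+j+1) x₀ = (j+1)(m+j+2) x₁ + (j+1) t x₁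
-- relating the two sides of the bound at j.
recurrence-balance : ∀ m j t x₀ x₁ x₂ → m ≡ j + suc t →
  suc j * suc (suc j) * x₂ + suc t * (m + suc j) * x₀ ≡ suc j * suc (m + m) * x₁ →
  suc j * suc (suc j) * x₂ + suc t * (m + suc j) * x₀
    ≡ suc j * suc (m + suc j) * x₁ + suc j * t * x₁
recurrence-balance m j t x₀ x₁ x₂ m≡j+1+t recurrence = begin
  suc j * suc (suc j) * x₂ + suc t * (m + suc j) * x₀ ≡⟨ recurrence ⟩
  suc j * suc (m + m) * x₁                           ≡⟨ cong (λ z → suc j * z * x₁) split ⟩
  suc j * (suc (m + suc j) + t) * x₁                 ≡⟨ solve (m ∷ j ∷ t ∷ x₁ ∷ []) ⟩
  suc j * suc (m + suc j) * x₁ + suc j * t * x₁      ∎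
  where
  open ≡-Reasoning
  split : suc (m + m) ≡ suc (m + suc j) + t
  split = subst (λ n → suc (n + n) ≡ suc (n + suc j) + t) (sym m≡j+1+t) (solve (j ∷ t ∷ []))

descent-step : ∀ K L R s w → w + R ≡ L + s → suc K * w ≤ K * s → suc K * L + s ≤ suc K * R
descent-step K L R s w balance Kw≤Ks = +-cancelʳ-≤ (K * s) _ _ (begin
  suc K * L + s + K * s    ≡⟨ solve (K ∷ L ∷ s ∷ []) ⟩
  suc K * (L + s)          ≡⟨ cong (suc K *_) balance ⟨
  suc K * (w + R)          ≡⟨ *-distribˡ-+ (suc K) w R ⟩
  suc K * w + suc K * R    ≤⟨ +-monoˡ-≤ (suc K * R) Kw≤Ks ⟩
  K * s + suc K * R        ≡⟨ +-comm (K * s) (suc K * R) ⟩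
  suc K * R + K * s        ∎)
  where open ≤-Reasoning

descent : ∀ m j t x₀ x₁ x₂ → m ≡ j + suc t →
  suc j * suc (suc j) * x₂ + suc t * (m + suc j) * x₀ ≡ suc j * suc (m + m) * x₁ →
  suc (suc j) * suc (m + suc (suc j)) * x₂ ≤ t * (m + suc (suc j)) * x₁ →
  suc (m + suc (suc j)) * (suc j * suc (m + suc j) * x₁) + suc j * t * x₁
    ≤ suc (m + suc (suc j)) * (suc t * (m + suc j) * x₀)
descent m j t x₀ x₁ x₂ m≡j+1+t recurrence next =
  descent-step (m + suc (suc j)) _ _ _ _ (recurrence-balance m j t x₀ x₁ x₂ m≡j+1+t recurrence)
    (begin
      suc (m + suc (suc j)) * (suc j * suc (suc j) * x₂)  ≡⟨ solve (m ∷ j ∷ x₂ ∷ []) ⟩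
      suc j * (suc (suc j) * suc (m + suc (suc j)) * x₂)  ≤⟨ *-monoʳ-≤ (suc j) next ⟩
      suc j * (t * (m + suc (suc j)) * x₁)                ≡⟨ solve (m ∷ j ∷ t ∷ x₁ ∷ []) ⟩
      (m + suc (suc j)) * (suc j * t * x₁)                ∎)
  where open ≤-Reasoning

Bounded : ℕ → ℕ → ℕ → Set
Bounded m j t = suc j * suc (m + suc j) * dSum (suc j) m ≤ t * (m + suc j) * dSum j m

dSum-descent : ∀ m j t → m ≡ j + suc t → Bounded m (suc j) t →
  suc (m + suc (suc j)) * (suc j * suc (m + suc j) * dSum (suc j) m) + suc j * t * dSum (suc j) m
    ≤ suc (m + suc (suc j)) * (suc t * (m + suc j) * dSum j m)
dSum-descent m j t m≡j+1+t =
  descent m j t (dSum j m) (dSum (suc j) m) (dSum (suc (suc j)) m) m≡j+1+t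
    (dSum-recurrence m j (suc t) m≡j+1+t)

-- The bound holds for every j ≤ m, by descending induction on j, i.e.
-- induction on t: for t = 0 the left side vanishes.
dSum-bound : ∀ m j t → m ≡ j + t → Bounded m j t
dSum-bound m j zero    m≡j+0 = ≤-trans (≤-reflexive vanishing) z≤n
  where
  vanishing : suc j * suc (m + suc j) * dSum (suc j) m ≡ 0
  vanishing = trans (cong (suc j * suc (m + suc j) *_)
                      (dSum-vanish (s≤s (≤-reflexive (trans m≡j+0 (+-identityʳ j))))))
                    (*-zeroʳ (suc j * suc (m + suc j)))
dSum-bound m j (suc t) m≡j+1+t =
  *-cancelˡ-≤ (suc (m + suc (suc j)))
    (≤-trans (m≤m+n _ _)
      (dSum-descent m j t m≡j+1+t (dSum-bound m (suc j) t (trans m≡j+1+t (+-suc j t)))))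

-- The bound is strict when  j + 2 ≤ m:  then the surplus is positive.
dSum-bound-strict : ∀ m j t → m ≡ j + suc (suc t) →
  suc j * suc (m + suc j) * dSum (suc j) m < suc (suc t) * (m + suc j) * dSum j m
dSum-bound-strict m j t m≡j+2+t =
  *-cancelˡ-< (suc (m + suc (suc j))) _ _ (<-≤-trans (m<m+n _ surplus>0)
    (dSum-descent m j (suc t) m≡j+2+t (dSum-bound m (suc j) (suc t) m≡j+1+[1+t])))
  where
  m≡j+1+[1+t] : m ≡ suc j + suc t
  m≡j+1+[1+t] = trans m≡j+2+t (+-suc j (suc t))
  surplus>0 : 0 < suc j * suc t * dSum (suc j) m
  surplus>0 = *-pos (*-pos {suc j} {suc t} (s≤s z≤n) (s≤s z≤n))
                (dSum-pos (subst (suc j ≤_) (sym m≡j+1+[1+t]) (s≤s (m≤m+n j (suc t)))))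

exchange : ∀ {u p q w} → w + u ≡ p + q → q ≤ p → p < u → u * w < p * q
exchange {u} {p} {q} {w} balance q≤p p<u with m≤n⇒∃[o]m+o≡n p<u
... | δ , refl = begin-strict
  suc (p + δ) * w       ≡⟨ solve (p ∷ δ ∷ w ∷ []) ⟩
  p * w + suc δ * w     <⟨ +-monoʳ-< (p * w) (*-monoʳ-< (suc δ) w<p) ⟩
  p * w + suc δ * p     ≡⟨ solve (p ∷ δ ∷ w ∷ []) ⟩
  p * (w + suc δ)       ≡⟨ cong (p *_) w+δ≡q ⟩
  p * q                 ∎
  where
  open ≤-Reasoning
  w+δ≡q : w + suc δ ≡ q
  w+δ≡q = +-cancelˡ-≡ p _ _ (begin-equality
    p + (w + suc δ)   ≡⟨ solve (p ∷ δ ∷ w ∷ []) ⟩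
    w + suc (p + δ)   ≡⟨ balance ⟩
    p + q             ∎)
  w<p : w < p
  w<p = <-≤-trans (subst (w <_) w+δ≡q (m<m+n w (s≤s z≤n))) q≤p

ratio-from-bound : ∀ m j t x₀ x₁ x₂ → m ≡ j + suc (suc t) →
  suc j * suc (suc j) * x₂ + suc (suc t) * (m + suc j) * x₀ ≡ suc j * suc (m + m) * x₁ →
  suc j * suc (m + suc j) * x₁ < suc (suc t) * (m + suc j) * x₀ →
  (suc t + 1) * (suc j + 1) * (m + suc j) * (x₀ * x₂)
    < (x₁ * x₁) * (suc t * suc j * (m + suc j + 1))
ratio-from-bound m j t x₀ x₁ x₂ m≡j+2+t recurrence bound = *-cancelˡ-< (suc j) _ _ (begin-strict
  suc j * ((suc t + 1) * (suc j + 1) * (m + suc j) * (x₀ * x₂))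
    ≡⟨ solve (m ∷ j ∷ t ∷ x₀ ∷ x₂ ∷ []) ⟩
  (suc (suc t) * (m + suc j) * x₀) * (suc j * suc (suc j) * x₂)
    <⟨ exchange balance q≤p bound ⟩
  (suc j * suc (m + suc j) * x₁) * (suc j * suc t * x₁)
    ≡⟨ solve (m ∷ j ∷ t ∷ x₁ ∷ []) ⟩
  suc j * ((x₁ * x₁) * (suc t * suc j * (m + suc j + 1))) ∎)
  where
  open ≤-Reasoning
  balance : suc j * suc (suc j) * x₂ + suc (suc t) * (m + suc j) * x₀
            ≡ suc j * suc (m + suc j) * x₁ + suc j * suc t * x₁
  balance = recurrence-balance m j (suc t) x₀ x₁ x₂ m≡j+2+t recurrence
  t≤m : t ≤ m
  t≤m = ≤-trans (≤-trans (n≤1+n t) (m≤n+m (suc t) (suc j)))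
                (≤-reflexive (trans (sym (+-suc j (suc t))) (sym m≡j+2+t)))
  q≤p : suc j * suc t * x₁ ≤ suc j * suc (m + suc j) * x₁
  q≤p = *-monoˡ-≤ x₁ (*-monoʳ-≤ (suc j) (s≤s (≤-trans t≤m (m≤m+n m (suc j)))))

toℚᵘ-/ : ∀ a n .{{_ : ℕ.NonZero n}} → ℚ.toℚᵘ ((+ a) ℚ./ n) ℚᵘ.≃ mkℚᵘ (+ a) (ℕ.pred n)
toℚᵘ-/ a (suc n) = ℚP.toℚᵘ-fromℚᵘ (mkℚᵘ (+ a) n)

ι-* : ∀ a b → ι (a * b) ≡ ι a ℚ.* ι b
ι-* a b = ℚP.toℚᵘ-injective (begin
  ℚ.toℚᵘ (ι (a * b))                 ≈⟨ toℚᵘ-/ (a * b) 1 ⟩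
  mkℚᵘ (+ (a * b)) 0                 ≡⟨ cong (λ z → mkℚᵘ z 0) (ℤP.pos-* a b) ⟩
  mkℚᵘ (+ a) 0 ℚᵘ.* mkℚᵘ (+ b) 0     ≈⟨ ℚᵘP.*-cong (toℚᵘ-/ a 1) (toℚᵘ-/ b 1) ⟨
  ℚ.toℚᵘ (ι a) ℚᵘ.* ℚ.toℚᵘ (ι b)     ≈⟨ ℚP.toℚᵘ-homo-* (ι a) (ι b) ⟨
  ℚ.toℚᵘ (ι a ℚ.* ι b)               ∎)
  where open ℚᵘP.≃-Reasoning

ι-< : ∀ {a b} → a < b → ι a ℚ.< ι b
ι-< {a} {b} a<b = ℚP.toℚᵘ-cancel-<
  (ℚᵘP.<-respˡ-≃ (ℚᵘP.≃-sym (toℚᵘ-/ a 1)) (ℚᵘP.<-respʳ-≃ (ℚᵘP.≃-sym (toℚᵘ-/ b 1))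
    (*<* (subst₂ ℤ._<_ (sym (ℤP.*-identityʳ (+ a))) (sym (ℤP.*-identityʳ (+ b))) (ℤ.+<+ a<b)))))

/-*-cancel : ∀ a n .{{_ : ℕ.NonZero n}} → ((+ a) ℚ./ n) ℚ.* ι n ≡ ι a
/-*-cancel a n@(suc n-1) = ℚP.toℚᵘ-injective (begin
  ℚ.toℚᵘ (((+ a) ℚ./ n) ℚ.* ι n)                ≈⟨ ℚP.toℚᵘ-homo-* ((+ a) ℚ./ n) (ι n) ⟩
  ℚ.toℚᵘ ((+ a) ℚ./ n) ℚᵘ.* ℚ.toℚᵘ (ι n)         ≈⟨ ℚᵘP.*-cong (toℚᵘ-/ a n) (toℚᵘ-/ n 1) ⟩
  mkℚᵘ (+ a) n-1 ℚᵘ.* mkℚᵘ (+ n) 0              ≈⟨ *≡* cross-multiplied ⟩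
  mkℚᵘ (+ a) 0                                  ≈⟨ toℚᵘ-/ a 1 ⟨
  ℚ.toℚᵘ (ι a)                                  ∎)
  where
  open ℚᵘP.≃-Reasoning
  cross-multiplied : (+ a ℤ.* + n) ℤ.* + 1 ≡ + a ℤ.* + (n * 1)
  cross-multiplied = trans (ℤP.*-identityʳ _) (cong (λ z → + a ℤ.* + z) (sym (*-identityʳ n)))

/-pos : ∀ {a} n .{{_ : ℕ.NonZero n}} → 0 < a → ℚ.Positive ((+ a) ℚ./ n)
/-pos {suc a} n _ = ℚP.normalize-pos (suc a) n

÷-*-cancel : ∀ p q r .{{_ : NonZero q}} → (p ÷ q) ℚ.* (q ℚ.* r) ≡ p ℚ.* r
÷-*-cancel p q r = begin
  (p ℚ.* ℚ.1/ q) ℚ.* (q ℚ.* r)   ≡⟨ ℚ-solve 4 (λ p q r q⁻¹ → (p :* q⁻¹) :* (q :* r) := (p :* r) :* (q :* q⁻¹))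
                                       refl p q r (ℚ.1/ q) ⟩
  (p ℚ.* r) ℚ.* (q ℚ.* ℚ.1/ q)   ≡⟨ cong ((p ℚ.* r) ℚ.*_) (ℚP.*-inverseʳ q) ⟩
  (p ℚ.* r) ℚ.* ℚ.1ℚ             ≡⟨ ℚP.*-identityʳ _ ⟩
  p ℚ.* r                        ∎
  where
  open ≡-Reasoning
  open +-*-Solver using (_:*_; _:=_) renaming (solve to ℚ-solve)

÷-< : ∀ p q r s .{{_ : NonZero q}} .{{_ : NonZero s}} → ℚ.Positive q → ℚ.Positive s →
      p ℚ.* s ℚ.< r ℚ.* q → p ÷ q ℚ.< r ÷ s
÷-< p q r s q>0 s>0 ps<rq = ℚP.*-cancelʳ-<-nonNeg (q ℚ.* s) {{qs≥0}} (begin-strict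
  (p ÷ q) ℚ.* (q ℚ.* s)   ≡⟨ ÷-*-cancel p q s ⟩
  p ℚ.* s                 <⟨ ps<rq ⟩
  r ℚ.* q                 ≡⟨ ÷-*-cancel r s q ⟨
  (r ÷ s) ℚ.* (s ℚ.* q)   ≡⟨ cong ((r ÷ s) ℚ.*_) (ℚP.*-comm s q) ⟩
  (r ÷ s) ℚ.* (q ℚ.* s)   ∎)
  where
  open ℚP.≤-Reasoning
  qs≥0 : ℚ.NonNegative (q ℚ.* s)
  qs≥0 = ℚP.pos⇒nonNeg (q ℚ.* s) {{ℚP.pos*pos⇒pos q {{q>0}} s {{s>0}}}}

clear-denominators : ∀ N x y K .{{_ : ℕ.NonZero K}} →
  (ι N ℚ.* (((+ x) ℚ./ K) ℚ.* ((+ y) ℚ./ K))) ℚ.* (ι K ℚ.* ι K) ≡ ι (N * (x * y))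
clear-denominators N x y K = begin
  (ι N ℚ.* (X ℚ.* Y)) ℚ.* (ι K ℚ.* ι K)
    ≡⟨ ℚ-solve 4 (λ n x y k → (n :* (x :* y)) :* (k :* k) := n :* ((x :* k) :* (y :* k)))
         refl (ι N) X Y (ι K) ⟩
  ι N ℚ.* ((X ℚ.* ι K) ℚ.* (Y ℚ.* ι K))
    ≡⟨ cong₂ (λ u v → ι N ℚ.* (u ℚ.* v)) (/-*-cancel x K) (/-*-cancel y K) ⟩
  ι N ℚ.* (ι x ℚ.* ι y)   ≡⟨ cong (ι N ℚ.*_) (ι-* x y) ⟨
  ι N ℚ.* ι (x * y)       ≡⟨ ι-* N (x * y) ⟨
  ι (N * (x * y))         ∎
  where
  open ≡-Reasoning
  open +-*-Solver using (_:*_; _:=_) renaming (solve to ℚ-solve)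
  X Y : ℚ
  X = (+ x) ℚ./ K
  Y = (+ y) ℚ./ K

ratio-transfer : ∀ N₁ N₂ a b c K .{{_ : ℕ.NonZero K}} →
  .{{_ : NonZero (((+ a) ℚ./ K) ℚ.* ((+ c) ℚ./ K))}} → .{{_ : NonZero (ι N₂)}} →
  0 < N₂ → 0 < a → 0 < c → N₁ * (a * c) < (b * b) * N₂ →
  (((+ b) ℚ./ K) ℚ.* ((+ b) ℚ./ K)) ÷ (((+ a) ℚ./ K) ℚ.* ((+ c) ℚ./ K)) > ι N₁ ÷ ι N₂
ratio-transfer N₁ N₂ a b c K N₂>0 a>0 c>0 ineq =
  ÷-< (ι N₁) (ι N₂) (b/K ℚ.* b/K) (a/K ℚ.* c/K) (/-pos 1 N₂>0)
    (ℚP.pos*pos⇒pos a/K {{/-pos K a>0}} c/K {{/-pos K c>0}})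
    (ℚP.*-cancelʳ-<-nonNeg (ι K ℚ.* ι K) {{K²≥0}} (begin-strict
      (ι N₁ ℚ.* (a/K ℚ.* c/K)) ℚ.* (ι K ℚ.* ι K)  ≡⟨ clear-denominators N₁ a c K ⟩
      ι (N₁ * (a * c))                            <⟨ ι-< ineq ⟩
      ι ((b * b) * N₂)                            ≡⟨ cong ι (*-comm (b * b) N₂) ⟩
      ι (N₂ * (b * b))                            ≡⟨ clear-denominators N₂ b b K ⟨
      (ι N₂ ℚ.* (b/K ℚ.* b/K)) ℚ.* (ι K ℚ.* ι K)
        ≡⟨ cong (ℚ._* (ι K ℚ.* ι K)) (ℚP.*-comm (ι N₂) (b/K ℚ.* b/K)) ⟩
      ((b/K ℚ.* b/K) ℚ.* ι N₂) ℚ.* (ι K ℚ.* ι K)  ∎))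
  where
  open ℚP.≤-Reasoning
  a/K b/K c/K : ℚ
  a/K = (+ a) ℚ./ K
  b/K = (+ b) ℚ./ K
  c/K = (+ c) ℚ./ K
  K>0 : ℚ.Positive (ι K)
  K>0 = /-pos 1 (ℕ.>-nonZero⁻¹ K)
  K²≥0 : ℚ.NonNegative (ι K ℚ.* ι K)
  K²≥0 = ℚP.pos⇒nonNeg (ι K ℚ.* ι K) {{ℚP.pos*pos⇒pos (ι K) {{K>0}} (ι K) {{K>0}}}}

dNum-pos : ∀ {i m} → i ≤ m → 0 < dNum i m
dNum-pos {i} {m} i≤m = subst (0 <_) (sym (dNum≡dSum i m)) (dSum-pos i≤m)

dNum-ratio : ∀ m i → 0 < i → i < m →
  (m ∸ i + 1) * (i + 1) * (m + i) * (dNum (i ∸ 1) m * dNum (suc i) m)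
    < (dNum i m * dNum i m) * ((m ∸ i) * i * (m + i + 1))
dNum-ratio m (suc j) _ i<m with m≤n⇒∃[o]m+o≡n i<m
... | t , refl
  rewrite dNum≡dSum j m | dNum≡dSum (suc j) m | dNum≡dSum (suc (suc j)) m
  = subst (λ s → (s + 1) * (suc j + 1) * (m + suc j) * (dSum j m * dSum (suc (suc j)) m)
                   < (dSum (suc j) m * dSum (suc j) m) * (s * suc j * (m + suc j + 1)))
      (sym m∸i≡1+t)
      (ratio-from-bound m j t (dSum j m) (dSum (suc j) m) (dSum (suc (suc j)) m) m≡j+2+t
        (dSum-recurrence m j (suc (suc t)) m≡j+2+t) (dSum-bound-strict m j t m≡j+2+t))
  where
  m≡j+2+t : suc (suc (j + t)) ≡ j + suc (suc t)
  m≡j+2+t = sym (trans (+-suc j (suc t)) (cong suc (+-suc j t)))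
  m∸i≡1+t : suc (j + t) ∸ j ≡ suc t
  m∸i≡1+t = trans (cong (_∸ j) (sym (+-suc j t))) (m+n∸m≡n j (suc t))

theorem1p2 : (m i : ℕ) → 2 ≤ m → 1 ≤ i → i ≤ m ∸ 1 →
    {{_ : NonZero (d (i ∸ 1) m ℚ.* d (suc i) m)}} →
    {{_ : NonZero (ι ((m ∸ i) * i * (m + i + 1)))}} →
    (d i m ℚ.* d i m) ÷ (d (i ∸ 1) m ℚ.* d (suc i) m)
    > ι ((m ∸ i + 1) * (i + 1) * (m + i)) ÷ ι ((m ∸ i) * i * (m + i + 1))
theorem1p2 m i 2≤m 1≤i i≤m∸1 =
  ratio-transfer ((m ∸ i + 1) * (i + 1) * (m + i)) ((m ∸ i) * i * (m + i + 1))
    (dNum (i ∸ 1) m) (dNum i m) (dNum (suc i) m) (2 ^ (2 * m)) {{m^n≢0 2 (2 * m)}}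
    N₂>0 (dNum-pos (≤-trans (m∸n≤m i 1) (<⇒≤ i<m))) (dNum-pos i<m) (dNum-ratio m i 1≤i i<m)
  where
  i<m : i < m
  i<m = subst (_≤ m) (+-comm i 1) (m≤o∸n⇒m+n≤o i (≤-trans (s≤s z≤n) 2≤m) i≤m∸1)
  N₂>0 : 0 < (m ∸ i) * i * (m + i + 1)
  N₂>0 = *-pos (*-pos (m<n⇒0<n∸m i<m) 1≤i) (m≤n+m 1 (m + i))
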